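{- Knapsack hiring, formulated as a 2-dimensional stochastic knapsack: there are $n$ items (candidates); item $i$ has value $v_i\ge0$, acceptance probability $p_i\in[0,1]$ and size $s_i\in[0,1]$; let $t\ge1$ be an integer and $v_i'=p_iv_i$. The knapsack has capacity vector $(1,1)$. When item $i$ is inserted, its realized size vector is $(s_i,1/t)$ with probability $p_i$ and $(0,1/t)$ otherwise, independently of other items. A policy adaptively inserts items not yet inserted, one at a time; an inserted item contributes value $v_i'$ if after its insertion the total realized size is at most $1$ in both coordinates; if some coordinate exceeds $1$, the process stops and that item contributes nothing; the policy may also stop at any time. Let $\mathrm{opt}$ be the maximum expected total value over all adaptive policies. Let $\mu(i)=(p_is_i,\,1/t)$ and $\|\mu(i)\|_1=p_is_i+1/t$. Let $m_1=\max_i v_i'$. Let $\mathcal{L}=(\mathcal{L}_1,\mathcal{L}_2,\dots)$ be the items with $\|\mu(i)\|_1\le 1/3$ sorted in non-increasing order of $v_i'/\|\mu(i)\|_1$, let $\ell$ be the largest integer such that $\sum_{r=1}^{\ell}\|\mu(\mathcal{L}_r)\|_1<1$, and let \[m_{\mathcal{L}}=\sum_{r=1}^{\ell}v'_{\mathcal{L}_r}\Big(1-\sum_{r'\le r}p_{\mathcal{L}_{r'}}s_{\mathcal{L}_{r'}}\Big).\] Consider the algorithm: if $m_1\ge m_{\mathcal{L}}$, insert only an item maximizing $v_i'$; otherwise insert the items of $\mathcal{L}$ in order until the knapsack overflows or the list is exhausted. Then the expected value of this algorithm is at least $\max\{m_1,m_{\mathcal{L}}\}$, and \[\mathrm{opt}\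 \le\ 10\cdot\max\{m_1,m_{\mathcal{L}}\}.\] In particular the algorithm is a $10$-approximation.
   Context: This models hiring with budget $1$ on the total size of hired candidates and at most $t$ offers, where candidate $i$ accepts with probability $p_i$; replacing the random value ($v_i$ with probability $p_i$) by the deterministic value $p_iv_i$ does not change the optimal expected value.
   Formalization: The values $v_i$, acceptance probabilities $p_i$ and sizes $s_i$ are rational numbers. -}

module Defs where

open import Data.Bool using (Bool; true; false; if_then_else_; _∧_)
open import Data.Nat as ℕ using (ℕ; NonZero)
open import Data.Fin using (Fin; _≟_)
open import Data.List using (List; []; _∷_; filter; allFin)
open import Data.Bool.ListAction using (any)
open import Relation.Nullary using (yes; no)
open import Data.Integer using (+_)
open import Data.Rational
  using (ℚ; 0ℚ; 1ℚ; _+_; _*_; _-_; _≤_; _<_; _≤ᵇ_; _/_; _⊔_)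
open import Data.Rational.Properties using (_≤?_; _<?_)
open import Relation.Nullary.Decidable using (⌊_⌋)

module Hiring (n t : ℕ) .{{_ : NonZero t}} (v p s : Fin n → ℚ) where

  invT : ℚ
  invT = + 1 / t

  v′ : Fin n → ℚ
  v′ i = p i * v i

  normμ : Fin n → ℚ
  normμ i = p i * s i + invT

  -- Adaptive (deterministic) policies as decision trees:
  -- `ins i k₁ k₀` inserts item i, then continues with k₁ if the item
  -- realized size (s_i, 1/t) (probability p_i) and with k₀ if it
  -- realized size (0, 1/t) (probability 1 - p_i); `stop` stops.
  data Policy : Set where
    stop : Policy
    ins  : Fin n → Policy → Policy → Policy

  isIn : Fin n → List (Fin n) → Bool
  isIn i S = any (λ j → ⌊ j ≟ i ⌋) S

  fits : ℚ → ℚ → Bool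
  fits u₁ u₂ = (u₁ ≤ᵇ 1ℚ) ∧ (u₂ ≤ᵇ 1ℚ)

  -- Expected value of a policy, from a state consisting of the list S of
  -- already inserted items and the current realized total size (u₁ , u₂).
  -- Inserting an already inserted item is not allowed; we treat it as
  -- stopping (contributing 0), which gives a policy no extra power.
  EV : Policy → List (Fin n) → ℚ → ℚ → ℚ
  EV stop S u₁ u₂ = 0ℚ
  EV (ins i k₁ k₀) S u₁ u₂ =
    if isIn i S then 0ℚ
    else (p i * branch k₁ (u₁ + s i) + (1ℚ - p i) * branch k₀ u₁)
    where
    branch : Policy → ℚ → ℚ
    branch k u₁′ =
      if fits u₁′ (u₂ + invT)
      then v′ i + EV k (i ∷ S) u₁′ (u₂ + invT)
      else 0ℚ

  value : Policy → ℚ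
  value π = EV π [] 0ℚ 0ℚ

  maxAux : List (Fin n) → ℚ
  maxAux []       = 0ℚ
  maxAux (i ∷ is) = v′ i ⊔ maxAux is

  m₁ : ℚ
  m₁ = maxAux (allFin n)

  argmaxAux : List (Fin n) → List (Fin n)
  argmaxAux []       = []
  argmaxAux (i ∷ is) with maxAux is ≤? v′ i
  ... | yes _ = i ∷ []
  ... | no  _ = argmaxAux is

  singlePolicy : Policy
  singlePolicy with argmaxAux (allFin n)
  ... | []    = stop
  ... | i ∷ _ = ins i stop stop

  small : List (Fin n)
  small = filter (λ i → normμ i ≤? (+ 1 / 3)) (allFin n)

  -- "i comes no later than j" in non-increasing order of v'/‖μ‖₁,
  -- i.e. v'_j/‖μ(j)‖₁ ≤ v'_i/‖μ(i)‖₁, written with cleared (positive)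
  -- denominators.
  RatioGeq : Fin n → Fin n → Set
  RatioGeq i j = v′ j * normμ i ≤ v′ i * normμ j

  -- m_L = Σ_{r ≤ ℓ} v'_{L_r} (1 - Σ_{r' ≤ r} p s), where ℓ is the largest
  -- integer with Σ_{r ≤ ℓ} ‖μ(L_r)‖₁ < 1.  Since every ‖μ‖₁ ≥ 1/t > 0 the
  -- prefix sums are strictly increasing, so ℓ is the length of the longest
  -- prefix whose norm-sum is < 1.
  -- accN = Σ_{r'<r} ‖μ‖₁,  accP = Σ_{r'<r} p s
  mLAux : ℚ → ℚ → List (Fin n) → ℚ
  mLAux accN accP []       = 0ℚ
  mLAux accN accP (i ∷ is) with (accN + normμ i) <? 1ℚ
  ... | yes _ =
        v′ i * (1ℚ - (accP + p i * s i))
        + mLAux (accN + normμ i) (accP + p i * s i) is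
  ... | no  _ = 0ℚ

  mL : List (Fin n) → ℚ
  mL L = mLAux 0ℚ 0ℚ L

  -- insert the items of L in order (the process itself stops at overflow)
  listPolicy : List (Fin n) → Policy
  listPolicy []       = stop
  listPolicy (i ∷ is) = ins i (listPolicy is) (listPolicy is)

  algorithm : List (Fin n) → Policy
  algorithm L with mL L ≤? m₁
  ... | yes _ = singlePolicy
  ... | no  _ = listPolicy L

{-# OPTIONS --safe #-}
module Submission where

-- Lower bound: the best single item always fits, and inserting L in order earns at least m_L
-- because m_L, as a function of the first-coordinate load it starts from, is affine; so each
-- random size s_i may be replaced by its mean p_i s_i, while the deterministic second
-- coordinate stays below 1 on the first ℓ items.
--
-- Upper bound, by a potential argument in the spirit of LP duality: if K ≥ 0 and c ≥ 0 satisfy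
-- v'_i ≤ K‖μ(i)‖₁ + c_i, then K(2 - u₁) + K(1 - u₂) + Σ_{j not inserted} c_j bounds the value
-- still obtainable from a state with load (u₁, u₂), since one insertion gains in expectation at
-- most what it removes from this quantity; hence opt ≤ 3K + Σ c.  Take M = max{m₁, m_L},
-- K = 3M and c_i = (v'_i - K‖μ(i)‖₁)⁺.  Large items have c_i = 0 because v'_i ≤ M < K‖μ(i)‖₁.
-- In ratio order c is positive only on a prefix of L, and comparing that prefix with m_L
-- forces Σ c ≤ M, so opt ≤ 9M + M.

open import Defs
open import Data.Nat using (ℕ; NonZero)
open import Data.Fin using (Fin)
open import Data.List using (List)
open import Data.Product using (_×_)
open import Data.Integer using (+_)
open import Data.Rational using (ℚ; 0ℚ; 1ℚ; _≤_; _*_; _⊔_; _/_)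
open import Data.List.Relation.Binary.Permutation.Propositional using (_↭_)
open import Data.List.Relation.Unary.Linked using (Linked)

open import Data.Bool using (true; false; if_then_else_; T)
open import Data.Bool.Properties using (T-∧; ¬-not; T-≡)
open import Data.Empty using (⊥-elim)
open import Data.Fin using (_≟_)
open import Data.List using ([]; _∷_; map; foldr; filter; allFin)
open import Data.List.Membership.Propositional using (_∈_; _∉_)
open import Data.List.Membership.Propositional.Properties using (∈-allFin)
open import Data.List.Relation.Unary.All as All using (All; []; _∷_)
open import Data.List.Relation.Unary.Any using (here; there)
import Data.List.Relation.Unary.Any as Any
open import Data.List.Relation.Unary.Any.Properties using (any⁻)
open import Data.List.Relation.Unary.Linked as Linked using ([-]; _∷_)
open import Data.List.Relation.Unary.AllPairs using (_∷_)
open import Data.List.Relation.Unary.Unique.Propositional using (Unique)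
import Data.List.Relation.Unary.Unique.Propositional.Properties as Unique
import Data.List.Relation.Unary.All.Properties as All
open import Data.Nat using (suc)
open import Data.Nat.Coprimality using (1-coprimeTo)
open import Data.Product using (_,_; proj₁; proj₂)
import Data.Product as Product
open import Data.Rational using (_+_; _-_; -_; _<_; ½; nonNegative; positive; *≤*)
open import Data.Rational.Properties hiding (_≟_)
import Data.Rational.Properties as ℚ
open import Function using (_∘_; Equivalence)
open import Level using (0ℓ)
open import Relation.Binary.PropositionalEquality
  using (_≡_; _≢_; refl; sym; trans; cong; cong₂; subst; setoid; module ≡-Reasoning)
open import Relation.Nullary using (¬_; yes; no; contradiction)
open import Relation.Nullary.Decidable using (dec⇒maybe; toWitness; T?)
open import Relation.Unary using (Pred; Decidable)
import Data.Integer as ℤ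
import Data.Nat as ℕ
import Data.List.Relation.Binary.Permutation.Propositional as ↭
import Data.List.Relation.Binary.Permutation.Propositional.Properties as ↭
import Data.List.Relation.Binary.Permutation.Setoid.Properties as ↭ₛ
open import Tactic.RingSolver using (solve-∀)
open import Algebra.Properties.Group +-0-group using (//-rightDividesʳ)
open import Tactic.RingSolver.Core.AlmostCommutativeRing
  using (AlmostCommutativeRing; fromCommutativeRing)

ℚ-ring : AlmostCommutativeRing 0ℓ 0ℓ
ℚ-ring = fromCommutativeRing +-*-commutativeRing (λ x → dec⇒maybe (0ℚ ℚ.≟ x))

*-nonNeg : ∀ {p q} → 0ℚ ≤ p → 0ℚ ≤ q → 0ℚ ≤ p * q
*-nonNeg {p} {q} 0≤p 0≤q =
  nonNegative⁻¹ (p * q) {{nonNeg*nonNeg⇒nonNeg p {{nonNegative 0≤p}} q {{nonNegative 0≤q}}}}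

*-pos : ∀ {p q} → 0ℚ < p → 0ℚ < q → 0ℚ < p * q
*-pos {p} {q} 0<p 0<q = positive⁻¹ (p * q) {{pos*pos⇒pos p {{positive 0<p}} q {{positive 0<q}}}}

+-nonNeg : ∀ {p q} → 0ℚ ≤ p → 0ℚ ≤ q → 0ℚ ≤ p + q
+-nonNeg = +-mono-≤

p≤q⇒0≤q-p : ∀ {p q} → p ≤ q → 0ℚ ≤ q - p
p≤q⇒0≤q-p {p} {q} p≤q = subst (_≤ q - p) (+-inverseʳ p) (+-monoˡ-≤ (- p) p≤q)

p<q⇒0<q-p : ∀ {p q} → p < q → 0ℚ < q - p
p<q⇒0<q-p {p} {q} p<q = subst (_< q - p) (+-inverseʳ p) (+-monoˡ-< (- p) p<q)

p≤q⇒p-q≤0 : ∀ {p q} → p ≤ q → p - q ≤ 0ℚ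
p≤q⇒p-q≤0 {p} {q} p≤q = subst (p - q ≤_) (+-inverseʳ q) (+-monoˡ-≤ (- q) p≤q)

p≤p+q : ∀ {p q} → 0ℚ ≤ q → p ≤ p + q
p≤p+q {p} {q} 0≤q = subst (_≤ p + q) (+-identityʳ p) (+-monoʳ-≤ p 0≤q)

p<p+q : ∀ {p q} → 0ℚ < q → p < p + q
p<p+q {p} {q} 0<q = subst (_< p + q) (+-identityʳ p) (+-monoʳ-< p 0<q)

p-q≤p : ∀ {p q} → 0ℚ ≤ q → p - q ≤ p
p-q≤p {p} {q} 0≤q = subst (p - q ≤_) (+-identityʳ p) (+-monoʳ-≤ p (neg-antimono-≤ 0≤q))

1≤2 : 1ℚ ≤ + 2 / 1
1≤2 = *≤* (ℤ.+≤+ (ℕ.s≤s ℕ.z≤n))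

1/n-pos : ∀ n .{{_ : NonZero n}} → 0ℚ < + 1 / n
1/n-pos n = positive⁻¹ (+ 1 / n) {{normalize-pos 1 n}}

1/n≤1 : ∀ n .{{_ : NonZero n}} → + 1 / n ≤ 1ℚ
1/n≤1 (suc k) rewrite normalize-coprime {1} {k} (1-coprimeTo (suc k)) = *≤* (ℤ.+≤+ (ℕ.s≤s ℕ.z≤n))

module _ {w y : ℚ} (0≤w : 0ℚ ≤ w) where

  w*[1-y]≥0 : y ≤ 1ℚ → 0ℚ ≤ w * (1ℚ - y)
  w*[1-y]≥0 y≤1 = *-nonNeg 0≤w (p≤q⇒0≤q-p y≤1)

  w*[1-y]≤w : 0ℚ ≤ y → w * (1ℚ - y) ≤ w
  w*[1-y]≤w 0≤y =
    subst (w * (1ℚ - y) ≤_) (*-identityʳ w) (*-monoˡ-≤-nonNeg w {{nonNegative 0≤w}} (p-q≤p 0≤y))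

  w*[1-y]≤0 : 1ℚ ≤ y → w * (1ℚ - y) ≤ 0ℚ
  w*[1-y]≤0 1≤y =
    subst (w * (1ℚ - y) ≤_) (*-zeroʳ w) (*-monoˡ-≤-nonNeg w {{nonNegative 0≤w}} (p≤q⇒p-q≤0 1≤y))

mix : ℚ → ℚ → ℚ → ℚ
mix a x y = a * x + (1ℚ - a) * y

mix-mono-≤ : ∀ {a x x′ y y′} → 0ℚ ≤ a × a ≤ 1ℚ → x ≤ x′ → y ≤ y′ → mix a x y ≤ mix a x′ y′
mix-mono-≤ {a} (0≤a , a≤1) x≤x′ y≤y′ =
  +-mono-≤ (*-monoˡ-≤-nonNeg a {{nonNegative 0≤a}} x≤x′)
           (*-monoˡ-≤-nonNeg (1ℚ - a) {{nonNegative (p≤q⇒0≤q-p a≤1)}} y≤y′)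

-- solve-∀ does not unfold definitions such as mix, hence the unfolded restatements.
mix-idem : ∀ a x → mix a x x ≡ x
mix-idem = unfolded
  where
  unfolded : ∀ a x → a * x + (1ℚ - a) * x ≡ x
  unfolded = solve-∀ ℚ-ring

mix-+ : ∀ a x′ x d → mix a (x′ + d) (x + d) ≡ mix a x′ x + d
mix-+ = unfolded
  where
  unfolded : ∀ a x′ x d → a * (x′ + d) + (1ℚ - a) * (x + d) ≡ (a * x′ + (1ℚ - a) * x) + d
  unfolded = solve-∀ ℚ-ring

mix-shift : ∀ a x d → mix a (x + d) x ≡ x + a * d
mix-shift = unfolded
  where
  unfolded : ∀ a x d → a * (x + d) + (1ℚ - a) * x ≡ x + a * d
  unfolded = solve-∀ ℚ-ring

mix-affine : ∀ a w y′ y A B →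
  mix a (w * (1ℚ - y′) + A) (w * (1ℚ - y) + B) ≡ w * (1ℚ - mix a y′ y) + mix a A B
mix-affine = unfolded
  where
  unfolded : ∀ a w y′ y A B →
    a * (w * (1ℚ - y′) + A) + (1ℚ - a) * (w * (1ℚ - y) + B)
      ≡ w * (1ℚ - (a * y′ + (1ℚ - a) * y)) + (a * A + (1ℚ - a) * B)
  unfolded = solve-∀ ℚ-ring

∑ : ∀ {A : Set} → (A → ℚ) → List A → ℚ
∑ f xs = foldr _+_ 0ℚ (map f xs)

module _ {A : Set} {f : A → ℚ} where

  ∑-nonNeg : (∀ x → 0ℚ ≤ f x) → ∀ xs → 0ℚ ≤ ∑ f xs
  ∑-nonNeg f≥0 []       = ≤-refl
  ∑-nonNeg f≥0 (x ∷ xs) = +-nonNeg (f≥0 x) (∑-nonNeg f≥0 xs)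

  ∑-zero : ∀ {xs} → All (λ x → f x ≡ 0ℚ) xs → ∑ f xs ≡ 0ℚ
  ∑-zero []            = refl
  ∑-zero (fx≡0 ∷ f≡0) = cong₂ _+_ fx≡0 (∑-zero f≡0)

  ∑-↭ : ∀ {xs ys} → xs ↭ ys → ∑ f xs ≡ ∑ f ys
  ∑-↭ xs↭ys = ↭ₛ.foldr-commMonoid (setoid ℚ) +-0-isCommutativeMonoid (↭.↭⇒↭ₛ (↭.map⁺ f xs↭ys))

  ∑-filter : ∀ {P : Pred A 0ℓ} (P? : Decidable P) → (∀ x → ¬ P x → f x ≡ 0ℚ) →
             ∀ xs → ∑ f (filter P? xs) ≡ ∑ f xs
  ∑-filter P? f≡0 [] = refl
  ∑-filter P? f≡0 (x ∷ xs) with P? x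
  ... | yes _  = cong (_+_ (f x)) (∑-filter P? f≡0 xs)
  ... | no ¬Px = begin
    ∑ f (filter P? xs)  ≡⟨ ∑-filter P? f≡0 xs ⟩
    ∑ f xs              ≡⟨ +-identityˡ (∑ f xs) ⟨
    0ℚ + ∑ f xs         ≡⟨ cong (_+ ∑ f xs) (f≡0 x ¬Px) ⟨
    f x + ∑ f xs        ∎
    where open ≡-Reasoning

  ∑-mono-≤ : ∀ {g} → (∀ x → f x ≤ g x) → ∀ xs → ∑ f xs ≤ ∑ g xs
  ∑-mono-≤ f≤g []       = ≤-refl
  ∑-mono-≤ f≤g (x ∷ xs) = +-mono-≤ (f≤g x) (∑-mono-≤ f≤g xs)

  ∑-mono-≤-at : ∀ {g x xs d} → (∀ y → f y ≤ g y) → x ∈ xs → f x + d ≤ g x → ∑ f xs + d ≤ ∑ g xs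
  ∑-mono-≤-at {g} {x} {_ ∷ xs} {d} f≤g (here refl) gain = begin
    (f x + ∑ f xs) + d  ≡⟨ +-exchange (f x) (∑ f xs) d ⟩
    (f x + d) + ∑ f xs  ≤⟨ +-mono-≤ gain (∑-mono-≤ f≤g xs) ⟩
    g x + ∑ g xs        ∎
    where
    open ≤-Reasoning
    +-exchange : ∀ a b c → (a + b) + c ≡ (a + c) + b
    +-exchange = solve-∀ ℚ-ring
  ∑-mono-≤-at {g} {_} {y ∷ xs} {d} f≤g (there x∈xs) gain = begin
    (f y + ∑ f xs) + d  ≡⟨ +-assoc (f y) (∑ f xs) d ⟩
    f y + (∑ f xs + d)  ≤⟨ +-mono-≤ (f≤g y) (∑-mono-≤-at f≤g x∈xs gain) ⟩
    g y + ∑ g xs        ∎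
    where open ≤-Reasoning

-- If n₁, n₂, … ≤ 1/3 have prefix sums N₁, N₂, … and total N, then
-- Σ_r n_r (1 - N_r) ≥ N - (N² + N/3)/2 = φ N.  Hence a prefix of L of total norm N whose
-- values exceed K‖μ‖₁ by G in total contributes at least prefixBound K G N to m_L.
φ : ℚ → ℚ
φ N = (+ 5 / 6) * N - ½ * (N * N)

prefixBound : ℚ → ℚ → ℚ → ℚ
prefixBound K G N = G * (1ℚ - N) + K * φ N

prefixBound-empty : ∀ K → prefixBound K 0ℚ 0ℚ ≡ 0ℚ
prefixBound-empty = identity
  where
  identity : ∀ K → 0ℚ * (1ℚ - 0ℚ) + K * ((+ 5 / 6) * 0ℚ - ½ * (0ℚ * 0ℚ)) ≡ 0ℚ
  identity = solve-∀ ℚ-ring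

prefixBound-step : ∀ {K G N w m P′} → 0ℚ ≤ K → 0ℚ ≤ G → 0ℚ ≤ w → 0ℚ ≤ m → m ≤ + 1 / 3 →
  P′ ≤ N + m → prefixBound K (G + (w - K * m)) (N + m) ≤ prefixBound K G N + w * (1ℚ - P′)
prefixBound-step {K} {G} {N} {w} {m} {P′} 0≤K 0≤G 0≤w 0≤m m≤⅓ P′≤N+m = begin
  prefixBound K (G + (w - K * m)) (N + m)                          ≤⟨ p≤p+q slack≥0 ⟩
  prefixBound K (G + (w - K * m)) (N + m) + slack                  ≡⟨ identity K G N w m P′ ⟨
  prefixBound K G N + w * (1ℚ - P′)                                ∎
  where
  open ≤-Reasoning
  slack = G * m + w * ((N + m) - P′) + ½ * K * m * (+ 1 / 3 - m)
  slack≥0 : 0ℚ ≤ slack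
  slack≥0 = +-nonNeg (+-nonNeg (*-nonNeg 0≤G 0≤m) (*-nonNeg 0≤w (p≤q⇒0≤q-p P′≤N+m)))
                     (*-nonNeg (*-nonNeg (*-nonNeg (<⇒≤ (positive⁻¹ ½)) 0≤K) 0≤m) (p≤q⇒0≤q-p m≤⅓))
  identity : ∀ K G N w m P′ →
    G * (1ℚ - N) + K * ((+ 5 / 6) * N - ½ * (N * N)) + w * (1ℚ - P′)
      ≡ (G + (w - K * m)) * (1ℚ - (N + m)) + K * ((+ 5 / 6) * (N + m) - ½ * ((N + m) * (N + m)))
        + (G * m + w * ((N + m) - P′) + ½ * K * m * (+ 1 / 3 - m))
  identity = solve-∀ ℚ-ring

prefixBound≤M⇒G≤M : ∀ {M G N} → 0ℚ ≤ M → 0ℚ ≤ N → N < 1ℚ →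
  prefixBound (+ 3 / 1 * M) G N ≤ M → G ≤ M
prefixBound≤M⇒G≤M {M} {G} {N} 0≤M 0≤N N<1 bound≤M =
  *-cancelʳ-≤-pos (1ℚ - N) {{positive (p<q⇒0<q-p N<1)}} (begin
    G * (1ℚ - N)          ≤⟨ p≤p+q slack≥0 ⟩
    G * (1ℚ - N) + slack  ≡⟨ identity M G N ⟨
    M * (1ℚ - N)          ∎)
  where
  open ≤-Reasoning
  slack = (M - prefixBound (+ 3 / 1 * M) G N) + + 3 / 2 * M * N * (1ℚ - N)
  slack≥0 : 0ℚ ≤ slack
  slack≥0 = +-nonNeg (p≤q⇒0≤q-p bound≤M)
                     (*-nonNeg (*-nonNeg (*-nonNeg (<⇒≤ (positive⁻¹ (+ 3 / 2))) 0≤M) 0≤N)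
                               (p≤q⇒0≤q-p (<⇒≤ N<1)))
  identity : ∀ M G N → M * (1ℚ - N) ≡ G * (1ℚ - N) +
    ((M - (G * (1ℚ - N) + + 3 / 1 * M * ((+ 5 / 6) * N - ½ * (N * N))))
      + + 3 / 2 * M * N * (1ℚ - N))
  identity = solve-∀ ℚ-ring

M<prefixBound : ∀ {M G N} → 0ℚ ≤ M → + 2 / 3 ≤ N → N < 1ℚ → 0ℚ < G →
  M < prefixBound (+ 3 / 1 * M) G N
M<prefixBound {M} {G} {N} 0≤M ⅔≤N N<1 0<G = begin-strict
  M                                   <⟨ p<p+q surplus>0 ⟩
  M + surplus                         ≡⟨ identity M G N ⟨
  prefixBound (+ 3 / 1 * M) G N       ∎
  where
  open ≤-Reasoning
  surplus = G * (1ℚ - N) + + 3 / 2 * M * (N - + 2 / 3) * (1ℚ - N)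
  surplus>0 : 0ℚ < surplus
  surplus>0 = +-mono-<-≤ (*-pos 0<G (p<q⇒0<q-p N<1))
    (*-nonNeg (*-nonNeg (*-nonNeg (<⇒≤ (positive⁻¹ (+ 3 / 2))) 0≤M) (p≤q⇒0≤q-p ⅔≤N))
              (p≤q⇒0≤q-p (<⇒≤ N<1)))
  identity : ∀ M G N →
    G * (1ℚ - N) + + 3 / 1 * M * ((+ 5 / 6) * N - ½ * (N * N))
      ≡ M + (G * (1ℚ - N) + + 3 / 2 * M * (N - + 2 / 3) * (1ℚ - N))
  identity = solve-∀ ℚ-ring

¬N+m<1⇒⅔≤N : ∀ {N m} → m ≤ + 1 / 3 → ¬ N + m < 1ℚ → + 2 / 3 ≤ N
¬N+m<1⇒⅔≤N {N} {m} m≤⅓ N+m≮1 = begin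
  + 2 / 3        ≡⟨⟩
  1ℚ - + 1 / 3   ≤⟨ +-mono-≤ (≮⇒≥ N+m≮1) (neg-antimono-≤ m≤⅓) ⟩
  (N + m) - m    ≡⟨ //-rightDividesʳ m N ⟩
  N              ∎
  where open ≤-Reasoning

module Knapsack (n t : ℕ) .{{_ : NonZero t}} (v p s : Fin n → ℚ)
  (v≥0 : ∀ i → 0ℚ ≤ v i) (p∈[0,1] : ∀ i → 0ℚ ≤ p i × p i ≤ 1ℚ)
  (s∈[0,1] : ∀ i → 0ℚ ≤ s i × s i ≤ 1ℚ) where

  open Hiring n t v p s

  v′≥0 : ∀ i → 0ℚ ≤ v′ i
  v′≥0 i = *-nonNeg (proj₁ (p∈[0,1] i)) (v≥0 i)

  ps≥0 : ∀ i → 0ℚ ≤ p i * s i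
  ps≥0 i = *-nonNeg (proj₁ (p∈[0,1] i)) (proj₁ (s∈[0,1] i))

  invT≤normμ : ∀ i → invT ≤ normμ i
  invT≤normμ i = subst (_≤ normμ i) (+-identityˡ invT) (+-monoˡ-≤ invT (ps≥0 i))

  ps≤normμ : ∀ i → p i * s i ≤ normμ i
  ps≤normμ i = p≤p+q (<⇒≤ (1/n-pos t))

  normμ>0 : ∀ i → 0ℚ < normμ i
  normμ>0 i = <-≤-trans (1/n-pos t) (invT≤normμ i)

  fits⁺ : ∀ {a b} → a ≤ 1ℚ → b ≤ 1ℚ → T (fits a b)
  fits⁺ a≤1 b≤1 = Equivalence.from T-∧ (≤⇒≤ᵇ a≤1 , ≤⇒≤ᵇ b≤1)

  fits⁻ : ∀ {a b} → T (fits a b) → a ≤ 1ℚ × b ≤ 1ℚ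
  fits⁻ fit = Product.map ≤ᵇ⇒≤ ≤ᵇ⇒≤ (Equivalence.to T-∧ fit)

  overflow⇒1<a : ∀ {a b} → ¬ T (fits a b) → b ≤ 1ℚ → 1ℚ < a
  overflow⇒1<a {a} ¬fit b≤1 with a ≤? 1ℚ
  ... | yes a≤1 = contradiction (fits⁺ a≤1 b≤1) ¬fit
  ... | no  a≰1 = ≰⇒> a≰1

  ∉⇒¬isIn : ∀ {i S} → i ∉ S → isIn i S ≡ false
  ∉⇒¬isIn {i} {S} i∉S = ¬-not (i∉S ∘ isIn⇒∈ ∘ Equivalence.from T-≡)
    where
    isIn⇒∈ : T (isIn i S) → i ∈ S
    isIn⇒∈ = Any.map (sym ∘ toWitness) ∘ any⁻ _ S

  -- EV's local function branch, with its free variables as arguments.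
  branch : Fin n → List (Fin n) → ℚ → Policy → ℚ → ℚ
  branch i S u₂ k u₁ = if fits u₁ (u₂ + invT) then v′ i + EV k (i ∷ S) u₁ (u₂ + invT) else 0ℚ

  EV-ins : ∀ {i k₁ k₀ S u₁ u₂} → isIn i S ≡ false →
    EV (ins i k₁ k₀) S u₁ u₂ ≡ mix (p i) (branch i S u₂ k₁ (u₁ + s i)) (branch i S u₂ k₀ u₁)
  EV-ins fresh rewrite fresh = refl

  EV≥0 : ∀ π S u₁ u₂ → 0ℚ ≤ EV π S u₁ u₂
  EV≥0 stop          S u₁ u₂ = ≤-refl
  EV≥0 (ins i k₁ k₀) S u₁ u₂ with isIn i S
  ... | true  = ≤-refl
  ... | false = +-nonNeg (*-nonNeg (proj₁ (p∈[0,1] i)) (branch≥0 k₁ (u₁ + s i)))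
                         (*-nonNeg (p≤q⇒0≤q-p (proj₂ (p∈[0,1] i))) (branch≥0 k₀ u₁))
    where
    branch≥0 : ∀ k x → 0ℚ ≤ branch i S u₂ k x
    branch≥0 k x with fits x (u₂ + invT)
    ... | true  = +-nonNeg (v′≥0 i) (EV≥0 k (i ∷ S) x (u₂ + invT))
    ... | false = ≤-refl

  branch-fits : ∀ {i S u₂ k x} → T (fits x (u₂ + invT)) →
    branch i S u₂ k x ≡ v′ i + EV k (i ∷ S) x (u₂ + invT)
  branch-fits {i} {S} {u₂} {k} {x} fit with fits x (u₂ + invT)
  ... | true  = refl
  ... | false = ⊥-elim fit

  branch-overflow : ∀ {i S u₂ k x} → ¬ T (fits x (u₂ + invT)) → branch i S u₂ k x ≡ 0ℚ
  branch-overflow {i} {S} {u₂} {k} {x} ¬fit with fits x (u₂ + invT)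
  ... | true  = contradiction _ ¬fit
  ... | false = refl

  single-item : ∀ i → v′ i ≤ value (ins i stop stop)
  single-item i = ≤-reflexive (begin
    v′ i                      ≡⟨ mix-idem (p i) (v′ i) ⟨
    mix (p i) (v′ i) (v′ i)   ≡⟨ cong₂ (mix (p i)) (fitted (from-empty (proj₂ (s∈[0,1] i)))) (fitted 0≤1) ⟩
    value (ins i stop stop)   ∎)
    where
    open ≡-Reasoning
    from-empty : ∀ {x} → x ≤ 1ℚ → 0ℚ + x ≤ 1ℚ
    from-empty {x} = subst (_≤ 1ℚ) (sym (+-identityˡ x))
    0≤1 : 0ℚ ≤ 1ℚ
    0≤1 = <⇒≤ (positive⁻¹ 1ℚ)
    fitted : ∀ {x} → x ≤ 1ℚ → v′ i ≡ branch i [] 0ℚ stop x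
    fitted {x} x≤1 = trans (sym (+-identityʳ (v′ i)))
      (sym (branch-fits {i} {[]} {0ℚ} {stop} {x} (fits⁺ x≤1 (from-empty (1/n≤1 t)))))

  headValue : List (Fin n) → ℚ
  headValue []      = 0ℚ
  headValue (i ∷ _) = v′ i

  maxAux≤headValue∘argmaxAux : ∀ is → maxAux is ≤ headValue (argmaxAux is)
  maxAux≤headValue∘argmaxAux []       = ≤-refl
  maxAux≤headValue∘argmaxAux (i ∷ is) with maxAux is ≤? v′ i
  ... | yes max≤v′ = ⊔-lub ≤-refl max≤v′
  ... | no  max≰v′ = ⊔-lub (≤-trans (<⇒≤ (≰⇒> max≰v′)) ih) ih
    where ih = maxAux≤headValue∘argmaxAux is

  m₁≤value-singlePolicy : m₁ ≤ value singlePolicy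
  m₁≤value-singlePolicy = ≤-trans (maxAux≤headValue∘argmaxAux (allFin n)) headValue≤value
    where
    headValue≤value : headValue (argmaxAux (allFin n)) ≤ value singlePolicy
    headValue≤value with argmaxAux (allFin n)
    ... | []    = ≤-refl
    ... | i ∷ _ = single-item i

  v′≤maxAux : ∀ {i is} → i ∈ is → v′ i ≤ maxAux is
  v′≤maxAux {i} {_ ∷ is} (here refl)   = p≤p⊔q (v′ i) (maxAux is)
  v′≤maxAux {i} {j ∷ is} (there i∈is) = p≤q⇒p≤r⊔q (v′ j) (v′≤maxAux i∈is)

  v′≤m₁ : ∀ i → v′ i ≤ m₁
  v′≤m₁ i = v′≤maxAux (∈-allFin i)


  -- When item i is among the first ℓ items, mLAux N P (i ∷ is) ≡ mLFrom N i is (P + p i * s i).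
  mLFrom : ℚ → Fin n → List (Fin n) → ℚ → ℚ
  mLFrom N i is y = v′ i * (1ℚ - y) + mLAux (N + normμ i) y is

  mLAux-nonNeg : ∀ N P is → P ≤ N → 0ℚ ≤ mLAux N P is
  mLFrom-nonNeg : ∀ N P i is → P ≤ N → N + normμ i < 1ℚ → 0ℚ ≤ mLFrom N i is (P + p i * s i)

  mLAux-nonNeg N P []       P≤N = ≤-refl
  mLAux-nonNeg N P (i ∷ is) P≤N with N + normμ i <? 1ℚ
  ... | no  _    = ≤-refl
  ... | yes N′<1 = mLFrom-nonNeg N P i is P≤N N′<1

  mLFrom-nonNeg N P i is P≤N N′<1 =
    +-nonNeg (w*[1-y]≥0 (v′≥0 i) (<⇒≤ (≤-<-trans P′≤N′ N′<1))) (mLAux-nonNeg (N + normμ i) _ is P′≤N′)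
    where
    P′≤N′ : P + p i * s i ≤ N + normμ i
    P′≤N′ = +-mono-≤ P≤N (ps≤normμ i)

  mLAux-nonPos : ∀ N y is → 1ℚ ≤ y → mLAux N y is ≤ 0ℚ
  mLAux-nonPos N y []       1≤y = ≤-refl
  mLAux-nonPos N y (i ∷ is) 1≤y with N + normμ i <? 1ℚ
  ... | no  _ = ≤-refl
  ... | yes _ = mLFrom-nonPos N i is (≤-trans 1≤y (p≤p+q (ps≥0 i)))
    where
    mLFrom-nonPos : ∀ N i is {y} → 1ℚ ≤ y → mLFrom N i is y ≤ 0ℚ
    mLFrom-nonPos N i is 1≤y = +-mono-≤ (w*[1-y]≤0 (v′≥0 i) 1≤y) (mLAux-nonPos (N + normμ i) _ is 1≤y)

  mLAux-affine : ∀ a N y′ y is → mix a (mLAux N y′ is) (mLAux N y is) ≡ mLAux N (mix a y′ y) is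
  mLFrom-affine : ∀ a N i is y′ y → mix a (mLFrom N i is y′) (mLFrom N i is y) ≡ mLFrom N i is (mix a y′ y)

  mLAux-affine a N y′ y []       = mix-idem a 0ℚ
  mLAux-affine a N y′ y (i ∷ is) with N + normμ i <? 1ℚ
  ... | no  _ = mix-idem a 0ℚ
  ... | yes _ = trans (mLFrom-affine a N i is (y′ + p i * s i) (y + p i * s i))
                      (cong (mLFrom N i is) (mix-+ a y′ y (p i * s i)))

  mLFrom-affine a N i is y′ y =
    trans (mix-affine a (v′ i) y′ y _ _)
          (cong (_+_ (v′ i * (1ℚ - mix a y′ y))) (mLAux-affine a (N + normμ i) y′ y is))

  mLFrom-mean : ∀ N i is y →
    mLFrom N i is (y + p i * s i) ≡ mix (p i) (mLFrom N i is (y + s i)) (mLFrom N i is y)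
  mLFrom-mean N i is y =
    sym (trans (mLFrom-affine (p i) N i is (y + s i) y) (cong (mLFrom N i is) (mix-shift (p i) y (s i))))

  mLFrom≤branch : ∀ {N i is S u₂ k x y} → u₂ + invT ≤ 1ℚ → x ≤ y → 0ℚ ≤ y →
    (x ≤ 1ℚ → mLAux (N + normμ i) y is ≤ EV k (i ∷ S) x (u₂ + invT)) →
    mLFrom N i is y ≤ branch i S u₂ k x
  mLFrom≤branch {N} {i} {is} {S} {u₂} {k} {x} {y} u₂′≤1 x≤y 0≤y mLAux≤EV
    with T? (fits x (u₂ + invT))
  ... | yes fit = begin
    mLFrom N i is y                     ≤⟨ +-mono-≤ (w*[1-y]≤w (v′≥0 i) 0≤y)
                                                    (mLAux≤EV (proj₁ (fits⁻ {x} {u₂ + invT} fit))) ⟩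
    v′ i + EV k (i ∷ S) x (u₂ + invT)   ≡⟨ branch-fits {i} {S} {u₂} {k} fit ⟨
    branch i S u₂ k x                   ∎
    where open ≤-Reasoning
  ... | no ¬fit = begin
    mLFrom N i is y    ≤⟨ +-mono-≤ (w*[1-y]≤0 (v′≥0 i) 1≤y) (mLAux-nonPos (N + normμ i) y is 1≤y) ⟩
    0ℚ                 ≡⟨ branch-overflow {i} {S} {u₂} {k} ¬fit ⟨
    branch i S u₂ k x  ∎
    where
    open ≤-Reasoning
    1≤y : 1ℚ ≤ y
    1≤y = <⇒≤ (<-≤-trans (overflow⇒1<a {x} ¬fit u₂′≤1) x≤y)

  ∉-∷ : ∀ {i j : Fin n} {S} → i ≢ j → j ∉ S → j ∉ i ∷ S
  ∉-∷ i≢j j∉S (here j≡i)  = i≢j (sym j≡i)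
  ∉-∷ i≢j j∉S (there j∈S) = j∉S j∈S

  -- q is a pessimistic first-coordinate load: it dominates the realized load u₁.
  mLAux≤EV-listPolicy : ∀ is N q S u₁ u₂ → Unique is → All (_∉ S) is →
    u₁ ≤ 1ℚ → u₁ ≤ q → 0ℚ ≤ q → u₂ ≤ N → mLAux N q is ≤ EV (listPolicy is) S u₁ u₂
  mLAux≤EV-listPolicy [] N q S u₁ u₂ _ _ _ _ _ _ = ≤-refl
  mLAux≤EV-listPolicy (i ∷ is) N q S u₁ u₂ (i≢is ∷ unique) (i∉S ∷ is∉S) u₁≤1 u₁≤q 0≤q u₂≤N
    with N + normμ i <? 1ℚ
  ... | no  _    = EV≥0 (listPolicy (i ∷ is)) S u₁ u₂
  ... | yes N′<1 = begin
    mLFrom N i is (q + p i * s i)                              ≡⟨ mLFrom-mean N i is q ⟩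
    mix (p i) (mLFrom N i is (q + s i)) (mLFrom N i is q)
      ≤⟨ mix-mono-≤ (p∈[0,1] i) (step (+-monoˡ-≤ (s i) u₁≤q) (+-nonNeg 0≤q (proj₁ (s∈[0,1] i))))
                                (step u₁≤q 0≤q) ⟩
    mix (p i) (branch i S u₂ k (u₁ + s i)) (branch i S u₂ k u₁)
      ≡⟨ EV-ins {i} {k} {k} {S} {u₁} {u₂} (∉⇒¬isIn i∉S) ⟨
    EV (listPolicy (i ∷ is)) S u₁ u₂                           ∎
    where
    open ≤-Reasoning
    k = listPolicy is
    u₂′≤N′ : u₂ + invT ≤ N + normμ i
    u₂′≤N′ = +-mono-≤ u₂≤N (invT≤normμ i)
    u₂′≤1 : u₂ + invT ≤ 1ℚ
    u₂′≤1 = <⇒≤ (≤-<-trans u₂′≤N′ N′<1)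
    step : ∀ {x y} → x ≤ y → 0ℚ ≤ y → mLFrom N i is y ≤ branch i S u₂ k x
    step {x} {y} x≤y 0≤y = mLFrom≤branch {N} {i} {is} {S} {u₂} {k} u₂′≤1 x≤y 0≤y λ x≤1 →
      mLAux≤EV-listPolicy is (N + normμ i) y (i ∷ S) x (u₂ + invT) unique
        (All.zipWith (Product.uncurry ∉-∷) (i≢is , is∉S)) x≤1 x≤y 0≤y u₂′≤N′

  mL≤value-listPolicy : ∀ L → Unique L → mL L ≤ value (listPolicy L)
  mL≤value-listPolicy L unique =
    mLAux≤EV-listPolicy L 0ℚ 0ℚ [] 0ℚ 0ℚ unique (All.tabulate (λ _ ()))
      (<⇒≤ (positive⁻¹ 1ℚ)) ≤-refl ≤-refl ≤-refl

  max≤value-algorithm : ∀ L → Unique L → m₁ ⊔ mL L ≤ value (algorithm L)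
  max≤value-algorithm L unique with mL L ≤? m₁
  ... | yes mL≤m₁ = subst (_≤ value singlePolicy) (sym (p≥q⇒p⊔q≡p mL≤m₁)) m₁≤value-singlePolicy
  ... | no  mL≰m₁ = subst (_≤ value (listPolicy L)) (sym (p≤q⇒p⊔q≡q (<⇒≤ (≰⇒> mL≰m₁))))
                          (mL≤value-listPolicy L unique)

  module Certificate (K : ℚ) (c : Fin n → ℚ) (0≤K : 0ℚ ≤ K) (c≥0 : ∀ i → 0ℚ ≤ c i)
                     (v′-Kμ≤c : ∀ i → v′ i - K * normμ i ≤ c i) where

    unused : List (Fin n) → Fin n → ℚ
    unused S j = if isIn j S then 0ℚ else c j

    unused≥0 : ∀ S j → 0ℚ ≤ unused S j
    unused≥0 S j with isIn j S
    ... | true  = ≤-refl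
    ... | false = c≥0 j

    unusedCost : List (Fin n) → ℚ
    unusedCost S = ∑ (unused S) (allFin n)

    unusedCost-insert : ∀ {i S} → isIn i S ≡ false → unusedCost (i ∷ S) + c i ≤ unusedCost S
    unusedCost-insert {i} {S} fresh = ∑-mono-≤-at shrinks (∈-allFin i) drops
      where
      shrinks : ∀ j → unused (i ∷ S) j ≤ unused S j
      shrinks j with i ≟ j
      ... | yes _ = unused≥0 S j
      ... | no  _ = ≤-refl
      drops : unused (i ∷ S) i + c i ≤ unused S i
      drops rewrite fresh with i ≟ i
      ... | yes _   = ≤-reflexive (+-identityˡ (c i))
      ... | no  i≢i = contradiction refl i≢i

    -- The first coordinate may reach 2 on an overflowing insertion, where the potential must
    -- still be nonnegative.
    potential : List (Fin n) → ℚ → ℚ → ℚ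
    potential S u₁ u₂ = K * (+ 2 / 1 - u₁) + K * (1ℚ - u₂) + unusedCost S

    potential≥0 : ∀ S {u₁ u₂} → u₁ ≤ + 2 / 1 → u₂ ≤ 1ℚ → 0ℚ ≤ potential S u₁ u₂
    potential≥0 S u₁≤2 u₂≤1 =
      +-nonNeg (+-nonNeg (*-nonNeg 0≤K (p≤q⇒0≤q-p u₁≤2)) (*-nonNeg 0≤K (p≤q⇒0≤q-p u₂≤1)))
               (∑-nonNeg (unused≥0 S) (allFin n))

    potential-insert : ∀ {i S u₁ u₂} → isIn i S ≡ false →
      mix (p i) (v′ i + potential (i ∷ S) (u₁ + s i) (u₂ + invT)) (v′ i + potential (i ∷ S) u₁ (u₂ + invT))
        ≤ potential S u₁ u₂
    potential-insert {i} {S} {u₁} {u₂} fresh = begin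
      mix (p i) (v′ i + potential (i ∷ S) (u₁ + s i) (u₂ + invT)) (v′ i + potential (i ∷ S) u₁ (u₂ + invT))
        ≡⟨ mean (p i) (v′ i) K u₁ u₂ (s i) invT (unusedCost (i ∷ S)) ⟩
      (v′ i - K * normμ i) + (K * (+ 2 / 1 - u₁) + K * (1ℚ - u₂) + unusedCost (i ∷ S))
        ≤⟨ +-monoˡ-≤ _ (v′-Kμ≤c i) ⟩
      c i + (K * (+ 2 / 1 - u₁) + K * (1ℚ - u₂) + unusedCost (i ∷ S))
        ≡⟨ rotate (c i) (K * (+ 2 / 1 - u₁)) (K * (1ℚ - u₂)) (unusedCost (i ∷ S)) ⟩
      K * (+ 2 / 1 - u₁) + K * (1ℚ - u₂) + (unusedCost (i ∷ S) + c i)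
        ≤⟨ +-monoʳ-≤ (K * (+ 2 / 1 - u₁) + K * (1ℚ - u₂)) (unusedCost-insert {i} {S} fresh) ⟩
      potential S u₁ u₂ ∎
      where
      open ≤-Reasoning
      mean : ∀ a w K u₁ u₂ x τ C →
        a * (w + (K * (+ 2 / 1 - (u₁ + x)) + K * (1ℚ - (u₂ + τ)) + C))
          + (1ℚ - a) * (w + (K * (+ 2 / 1 - u₁) + K * (1ℚ - (u₂ + τ)) + C))
          ≡ (w - K * (a * x + τ)) + (K * (+ 2 / 1 - u₁) + K * (1ℚ - u₂) + C)
      mean = solve-∀ ℚ-ring
      rotate : ∀ c X Y C → c + (X + Y + C) ≡ X + Y + (C + c)
      rotate = solve-∀ ℚ-ring

    EV≤potential : ∀ π S u₁ u₂ → u₁ ≤ 1ℚ → u₂ ≤ 1ℚ → EV π S u₁ u₂ ≤ potential S u₁ u₂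
    branch≤potential : ∀ i S u₂ k x → x ≤ + 2 / 1 → u₂ + invT ≤ 1ℚ →
                       branch i S u₂ k x ≤ v′ i + potential (i ∷ S) x (u₂ + invT)

    EV≤potential stop S u₁ u₂ u₁≤1 u₂≤1 = potential≥0 S (≤-trans u₁≤1 1≤2) u₂≤1
    EV≤potential (ins i k₁ k₀) S u₁ u₂ u₁≤1 u₂≤1 with isIn i S in fresh
    ... | true  = potential≥0 S (≤-trans u₁≤1 1≤2) u₂≤1
    ... | false with u₂ + invT ≤? 1ℚ
    ...   | yes u₂′≤1 = begin
      mix (p i) (branch i S u₂ k₁ (u₁ + s i)) (branch i S u₂ k₀ u₁)
        ≤⟨ mix-mono-≤ (p∈[0,1] i)
             (branch≤potential i S u₂ k₁ (u₁ + s i) (+-mono-≤ u₁≤1 (proj₂ (s∈[0,1] i))) u₂′≤1)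
             (branch≤potential i S u₂ k₀ u₁ (≤-trans u₁≤1 1≤2) u₂′≤1) ⟩
      mix (p i) (v′ i + potential (i ∷ S) (u₁ + s i) (u₂ + invT)) (v′ i + potential (i ∷ S) u₁ (u₂ + invT))
        ≤⟨ potential-insert {i} {S} {u₁} {u₂} fresh ⟩
      potential S u₁ u₂ ∎
      where open ≤-Reasoning
    ...   | no u₂′≰1 = begin
      mix (p i) (branch i S u₂ k₁ (u₁ + s i)) (branch i S u₂ k₀ u₁)
        ≡⟨ cong₂ (mix (p i)) (branch-overflow {i} {S} {u₂} {k₁} (u₂′≰1 ∘ proj₂ ∘ fits⁻ {u₁ + s i}))
                             (branch-overflow {i} {S} {u₂} {k₀} (u₂′≰1 ∘ proj₂ ∘ fits⁻ {u₁})) ⟩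
      mix (p i) 0ℚ 0ℚ  ≡⟨ mix-idem (p i) 0ℚ ⟩
      0ℚ               ≤⟨ potential≥0 S (≤-trans u₁≤1 1≤2) u₂≤1 ⟩
      potential S u₁ u₂ ∎
      where open ≤-Reasoning

    branch≤potential i S u₂ k x x≤2 u₂′≤1 with T? (fits x (u₂ + invT))
    ... | yes fit = begin
      branch i S u₂ k x                       ≡⟨ branch-fits {i} {S} {u₂} {k} fit ⟩
      v′ i + EV k (i ∷ S) x (u₂ + invT)       ≤⟨ +-monoʳ-≤ (v′ i) (EV≤potential k (i ∷ S) x (u₂ + invT)
                                                      (proj₁ (fits⁻ {x} {u₂ + invT} fit)) u₂′≤1) ⟩
      v′ i + potential (i ∷ S) x (u₂ + invT)  ∎
      where open ≤-Reasoning
    ... | no ¬fit = begin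
      branch i S u₂ k x                       ≡⟨ branch-overflow {i} {S} {u₂} {k} ¬fit ⟩
      0ℚ                                      ≤⟨ +-nonNeg (v′≥0 i) (potential≥0 (i ∷ S) x≤2 u₂′≤1) ⟩
      v′ i + potential (i ∷ S) x (u₂ + invT)  ∎
      where open ≤-Reasoning

    value≤certificate : ∀ π → value π ≤ K * (+ 2 / 1 - 0ℚ) + K * (1ℚ - 0ℚ) + ∑ c (allFin n)
    value≤certificate π = EV≤potential π [] 0ℚ 0ℚ 0≤1 0≤1
      where 0≤1 = <⇒≤ (positive⁻¹ 1ℚ)

  Small : Fin n → Set
  Small i = normμ i ≤ + 1 / 3

  module Excess (M : ℚ) (0≤M : 0ℚ ≤ M) (v′≤M : ∀ i → v′ i ≤ M) where

    K : ℚ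
    K = + 3 / 1 * M

    0≤K : 0ℚ ≤ K
    0≤K = *-nonNeg (<⇒≤ (positive⁻¹ (+ 3 / 1))) 0≤M

    excess : Fin n → ℚ
    excess i = 0ℚ ⊔ (v′ i - K * normμ i)

    excess≥0 : ∀ i → 0ℚ ≤ excess i
    excess≥0 i = p≤p⊔q 0ℚ (v′ i - K * normμ i)

    v′-Kμ≤excess : ∀ i → v′ i - K * normμ i ≤ excess i
    v′-Kμ≤excess i = p≤q⊔p 0ℚ (v′ i - K * normμ i)

    excess-below : ∀ {i} → v′ i ≤ K * normμ i → excess i ≡ 0ℚ
    excess-below v′≤Kμ = p≥q⇒p⊔q≡p (p≤q⇒p-q≤0 v′≤Kμ)

    excess-above : ∀ {i} → ¬ v′ i ≤ K * normμ i → excess i ≡ v′ i - K * normμ i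
    excess-above v′≰Kμ = p≤q⇒p⊔q≡q (<⇒≤ (p<q⇒0<q-p (≰⇒> v′≰Kμ)))

    excess-large : ∀ i → ¬ Small i → excess i ≡ 0ℚ
    excess-large i large = excess-below (begin
      v′ i               ≤⟨ v′≤M i ⟩
      M                  ≡⟨ identity M ⟨
      K * (+ 1 / 3)      ≤⟨ *-monoˡ-≤-nonNeg K {{nonNegative 0≤K}} (<⇒≤ (≰⇒> large)) ⟩
      K * normμ i        ∎)
      where
      open ≤-Reasoning
      identity : ∀ M → + 3 / 1 * M * (+ 1 / 3) ≡ M
      identity = solve-∀ ℚ-ring

    ratio-below : ∀ {i j} → RatioGeq i j → v′ i ≤ K * normμ i → v′ j ≤ K * normμ j
    ratio-below {i} {j} j≤i v′≤Kμ = *-cancelʳ-≤-pos (normμ i) {{positive (normμ>0 i)}} (begin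
      v′ j * normμ i          ≤⟨ j≤i ⟩
      v′ i * normμ j          ≤⟨ *-monoʳ-≤-nonNeg (normμ j) {{nonNegative (<⇒≤ (normμ>0 j))}} v′≤Kμ ⟩
      K * normμ i * normμ j   ≡⟨ identity K (normμ i) (normμ j) ⟩
      K * normμ j * normμ i   ∎)
      where
      open ≤-Reasoning
      identity : ∀ a b c → a * b * c ≡ a * c * b
      identity = solve-∀ ℚ-ring

    below-propagates : ∀ {i is} → Linked RatioGeq (i ∷ is) → v′ i ≤ K * normμ i →
                       All (λ j → v′ j ≤ K * normμ j) (i ∷ is)
    below-propagates [-]          v′≤Kμ = v′≤Kμ ∷ []
    below-propagates (j≤i ∷ rest) v′≤Kμ = v′≤Kμ ∷ below-propagates rest (ratio-below j≤i v′≤Kμ)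

    ∑-excess-below : ∀ {i is G} → Linked RatioGeq (i ∷ is) → v′ i ≤ K * normμ i → G ≤ M →
                     G + ∑ excess (i ∷ is) ≤ M
    ∑-excess-below {i} {is} {G} sorted v′≤Kμ G≤M = begin
      G + ∑ excess (i ∷ is)  ≡⟨ cong (_+_ G) (∑-zero (All.map excess-below (below-propagates sorted v′≤Kμ))) ⟩
      G + 0ℚ                 ≡⟨ +-identityʳ G ⟩
      G                      ≤⟨ G≤M ⟩
      M                      ∎
      where open ≤-Reasoning

    excess>0 : ∀ {i} → ¬ v′ i ≤ K * normμ i → 0ℚ < excess i
    excess>0 {i} v′≰Kμ = subst (0ℚ <_) (sym (excess-above v′≰Kμ)) (p<q⇒0<q-p (≰⇒> v′≰Kμ))

    prefixBound-extend : ∀ {N P G i is} → ¬ v′ i ≤ K * normμ i → Small i → 0ℚ ≤ G → P ≤ N →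
      prefixBound K (G + excess i) (N + normμ i) + mLAux (N + normμ i) (P + p i * s i) is
        ≤ prefixBound K G N + mLFrom N i is (P + p i * s i)
    prefixBound-extend {N} {P} {G} {i} {is} v′≰Kμ small 0≤G P≤N = begin
      prefixBound K (G + excess i) N′ + mLAux N′ P′ is
        ≡⟨ cong (λ e → prefixBound K (G + e) N′ + mLAux N′ P′ is) (excess-above v′≰Kμ) ⟩
      prefixBound K (G + (v′ i - K * normμ i)) N′ + mLAux N′ P′ is
        ≤⟨ +-monoˡ-≤ (mLAux N′ P′ is) (prefixBound-step {K} {G} {N} {v′ i} {normμ i} {P′} 0≤K 0≤G
                                         (v′≥0 i) (<⇒≤ (normμ>0 i)) small (+-mono-≤ P≤N (ps≤normμ i))) ⟩
      prefixBound K G N + v′ i * (1ℚ - P′) + mLAux N′ P′ is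
        ≡⟨ +-assoc (prefixBound K G N) (v′ i * (1ℚ - P′)) (mLAux N′ P′ is) ⟩
      prefixBound K G N + mLFrom N i is P′ ∎
      where
      open ≤-Reasoning
      N′ = N + normμ i
      P′ = P + p i * s i

    ∑-excess≤M : ∀ is N P G → Linked RatioGeq is → All Small is → 0ℚ ≤ N → N < 1ℚ → P ≤ N →
      0ℚ ≤ G → (0ℚ < N → 0ℚ < G) → prefixBound K G N + mLAux N P is ≤ M → G + ∑ excess is ≤ M
    ∑-excess≤M [] N P G _ _ 0≤N N<1 _ _ _ bound = begin
      G + 0ℚ   ≡⟨ +-identityʳ G ⟩
      G        ≤⟨ prefixBound≤M⇒G≤M {M} {G} {N} 0≤M 0≤N N<1 (subst (_≤ M) (+-identityʳ _) bound) ⟩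
      M        ∎
      where open ≤-Reasoning
    ∑-excess≤M (i ∷ is) N P G sorted (small ∷ smalls) 0≤N N<1 P≤N 0≤G N>0⇒G>0 bound
      with N + normμ i <? 1ℚ | v′ i ≤? K * normμ i
    ... | no N′≮1 | yes v′≤Kμ = ∑-excess-below sorted v′≤Kμ
      (prefixBound≤M⇒G≤M {M} {G} {N} 0≤M 0≤N N<1 (subst (_≤ M) (+-identityʳ _) bound))
    ... | no N′≮1 | no _ = ⊥-elim (<-irrefl refl (<-≤-trans
      (M<prefixBound {M} {G} {N} 0≤M ⅔≤N N<1 (N>0⇒G>0 (<-≤-trans (positive⁻¹ (+ 2 / 3)) ⅔≤N)))
      (subst (_≤ M) (+-identityʳ _) bound)))
      where
      ⅔≤N : + 2 / 3 ≤ N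
      ⅔≤N = ¬N+m<1⇒⅔≤N small N′≮1
    ... | yes N′<1 | yes v′≤Kμ = ∑-excess-below sorted v′≤Kμ
      (prefixBound≤M⇒G≤M {M} {G} {N} 0≤M 0≤N N<1 (≤-trans (p≤p+q (mLFrom-nonNeg N P i is P≤N N′<1)) bound))
    ... | yes N′<1 | no v′≰Kμ = begin
      G + (excess i + ∑ excess is)  ≡⟨ +-assoc G (excess i) (∑ excess is) ⟨
      (G + excess i) + ∑ excess is
        ≤⟨ ∑-excess≤M is (N + normμ i) (P + p i * s i) (G + excess i) (Linked.tail sorted) smalls
             (+-nonNeg 0≤N (<⇒≤ (normμ>0 i))) N′<1 (+-mono-≤ P≤N (ps≤normμ i))
             (+-nonNeg 0≤G (excess≥0 i)) (λ _ → G′>0)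
             (≤-trans (prefixBound-extend {N} {P} {G} {i} {is} v′≰Kμ small 0≤G P≤N) bound) ⟩
      M                             ∎
      where
      open ≤-Reasoning
      G′>0 : 0ℚ < G + excess i
      G′>0 = <-≤-trans (excess>0 v′≰Kμ) (subst (excess i ≤_) (+-comm (excess i) G) (p≤p+q 0≤G))

  module Approximation (L : List (Fin n)) (L↭small : L ↭ small) (sorted : Linked RatioGeq L) where

    unique : Unique L
    unique = ↭ₛ.Unique-resp-↭ (setoid (Fin n)) (↭.↭⇒↭ₛ (↭.↭-sym L↭small))
               (Unique.filter⁺ (λ i → normμ i ≤? + 1 / 3) (Unique.allFin⁺ n))

    all-small : All Small L
    all-small = ↭.All-resp-↭ (↭.↭-sym L↭small) (All.all-filter (λ i → normμ i ≤? + 1 / 3) (allFin n))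

    M : ℚ
    M = m₁ ⊔ mL L

    0≤M : 0ℚ ≤ M
    0≤M = ≤-trans (mLAux-nonNeg 0ℚ 0ℚ L ≤-refl) (p≤q⊔p m₁ (mL L))

    open Excess M 0≤M (λ i → ≤-trans (v′≤m₁ i) (p≤p⊔q m₁ (mL L)))
    open Certificate K excess 0≤K excess≥0 v′-Kμ≤excess

    ∑-excess-allFin≤M : ∑ excess (allFin n) ≤ M
    ∑-excess-allFin≤M = begin
      ∑ excess (allFin n)  ≡⟨ ∑-filter (λ i → normμ i ≤? + 1 / 3) excess-large (allFin n) ⟨
      ∑ excess small       ≡⟨ ∑-↭ L↭small ⟨
      ∑ excess L           ≡⟨ +-identityˡ (∑ excess L) ⟨
      0ℚ + ∑ excess L      ≤⟨ ∑-excess≤M L 0ℚ 0ℚ 0ℚ sorted all-small ≤-refl (positive⁻¹ 1ℚ) ≤-refl ≤-refl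
                                (λ 0<0 → 0<0) initial ⟩
      M                    ∎
      where
      open ≤-Reasoning
      initial : prefixBound K 0ℚ 0ℚ + mL L ≤ M
      initial = begin
        prefixBound K 0ℚ 0ℚ + mL L  ≡⟨ cong (_+ mL L) (prefixBound-empty K) ⟩
        0ℚ + mL L                   ≡⟨ +-identityˡ (mL L) ⟩
        mL L                        ≤⟨ p≤q⊔p m₁ (mL L) ⟩
        M                           ∎

    algorithm≥max : M ≤ value (algorithm L)
    algorithm≥max = max≤value-algorithm L unique

    value≤10max : ∀ π → value π ≤ + 10 / 1 * M
    value≤10max π = begin
      value π                                                    ≤⟨ value≤certificate π ⟩
      K * (+ 2 / 1 - 0ℚ) + K * (1ℚ - 0ℚ) + ∑ excess (allFin n)
        ≤⟨ +-monoʳ-≤ (K * (+ 2 / 1 - 0ℚ) + K * (1ℚ - 0ℚ)) ∑-excess-allFin≤M ⟩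
      K * (+ 2 / 1 - 0ℚ) + K * (1ℚ - 0ℚ) + M                     ≡⟨ identity M ⟩
      + 10 / 1 * M                                               ∎
      where
      open ≤-Reasoning
      identity : ∀ M → + 3 / 1 * M * (+ 2 / 1 - 0ℚ) + + 3 / 1 * M * (1ℚ - 0ℚ) + M ≡ + 10 / 1 * M
      identity = solve-∀ ℚ-ring

mainTheorem6 : (n t : ℕ) .{{_ : NonZero t}} (v p s : Fin n → ℚ) →
    (∀ i → 0ℚ ≤ v i) →
    (∀ i → 0ℚ ≤ p i × p i ≤ 1ℚ) →
    (∀ i → 0ℚ ≤ s i × s i ≤ 1ℚ) →
    (L : List (Fin n)) →
    L ↭ Hiring.small n t v p s →
    Linked (Hiring.RatioGeq n t v p s) L →
    (Hiring.m₁ n t v p s ⊔ Hiring.mL n t v p s L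
       ≤ Hiring.value n t v p s (Hiring.algorithm n t v p s L))
    × ((π : Hiring.Policy n t v p s) →
       Hiring.value n t v p s π
         ≤ (+ 10 / 1) * (Hiring.m₁ n t v p s ⊔ Hiring.mL n t v p s L))
mainTheorem6 n t v p s v≥0 p∈[0,1] s∈[0,1] L L↭small sorted = algorithm≥max , value≤10max
  where open Knapsack.Approximation n t v p s v≥0 p∈[0,1] s∈[0,1] L L↭small sorted
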